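{- For every finite matroid $M$, the set of friendly separations of $M$ is a nested set of separations; and hence it gives rise to a tree-decomposition of $M$ that efficiently distinguishes every pair of distinguishable tangles of $M$.
   Context: Let $M$ be a finite matroid with ground set $E$ and rank function $r$. A separation of $M$ is a set $\{A,B\}$ with $A\cup B=E$ and $A\cap B=\emptyset$; its order is $|\{A,B\}|=r(A)+r(B)-r(E)$. Two separations $\{A,B\},\{C,D\}$ are nested if, after possibly renaming sides, $A\subseteq C$ and $B\supseteq D$; otherwise they cross; a set of separations is nested if its elements are pairwise nested. For crossing $\{A,B\},\{C,D\}$ the corners are $\{X\cap Y,X'\cup Y'\}$ for $\{X,X'\}=\{A,B\}$, $\{Y,Y'\}=\{C,D\}$; two corners lie on the same side of $\{A,B\}$ if they use the same $X$. An entanglement of $M$ is a non-empty set $\varepsilon$ of separations such that: if $r\in\varepsilon$ is crossed by a separation $s$ of $M$ so that two corners on the same side of $r$ have order at most $|r|$, then at least one of them has order equal to $|r|$ and lies in $\varepsilon$. A separation is friendly if it lies in some entanglement $\varepsilon$ such that no other separation in $\varepsilon$ crosses fewer separations lying in entanglements of $M$ than it does. An oriented separation is an ordered pair $(A,B)$ with $\{A,B\}$ a separation. A tangle of order $k$ of $M$ is a set $\tau$ of oriented separations of order $<k$ containing exactly one of $(A,B),(B,A)$ for each separation of order $<k$, such that there are no $(A_1,B_1),(A_2,B_2),(A_3,B_3)\in\tau$ (not necessarily distinct) with $A_1\cup A_2\cup A_3=E$. A separation $\{A,B\}$ distinguishes tangles $\tau,\tau'$ if $(A,B)\in\tau,(B,A)\in\tau'$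 or vice versa; efficiently if its order is minimum among all distinguishing separations; tangles are distinguishable if some separation distinguishes them. A tree-decomposition of $M$ is a tree $T$ with a map $\varphi\colon E\to V(T)$; each edge $e$ of $T$ induces the separation $\{\varphi^{ -1}(V(T_1)),\varphi^{ -1}(V(T_2))\}$ where $T_1,T_2$ are the components of $T-e$; it efficiently distinguishes a pair of tangles if some edge-induced separation efficiently distinguishes them. -}

module Defs where

open import Data.Nat using (ℕ; zero; suc; _+_; _∸_; _≤_; _<_)
open import Data.Bool using (Bool; true; false)
open import Data.Fin using (Fin; zero; suc; toℕ)
open import Data.Fin.Subset using (Subset; _∪_; _∩_; ∁; _⊆_; ∣_∣; ⊤; _∈_)
open import Data.Product using (Σ; ∃; _×_; _,_)
open import Data.Sum using (_⊎_)
open import Data.List using (List; length)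
import Data.List.Membership.Propositional as L
open import Data.List.Relation.Unary.Unique.Propositional using (Unique)
open import Relation.Nullary using (¬_)
open import Relation.Binary.PropositionalEquality using (_≡_; _≢_)

record Matroid (n : ℕ) : Set where
  field
    rank        : Subset n → ℕ
    rank-≤-card : ∀ X → rank X ≤ ∣ X ∣
    rank-mono   : ∀ X Y → X ⊆ Y → rank X ≤ rank Y
    rank-submod : ∀ X Y → rank (X ∪ Y) + rank (X ∩ Y) ≤ rank X + rank Y

module _ {n : ℕ} (M : Matroid n) where
  open Matroid M

  -- A separation {A, B} of M is represented by one of its sides A
  -- (the other side being B = ∁ A).  Its order r(A) + r(B) - r(E).
  order : Subset n → ℕ
  order A = rank A + rank (∁ A) ∸ rank ⊤

nestedOriented : {n : ℕ} → Subset n → Subset n → Set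
nestedOriented X Y = X ⊆ Y × ∁ Y ⊆ ∁ X

Nested : {n : ℕ} → Subset n → Subset n → Set
Nested A C = nestedOriented A C ⊎ nestedOriented A (∁ C)
           ⊎ nestedOriented (∁ A) C ⊎ nestedOriented (∁ A) (∁ C)

Crosses : {n : ℕ} → Subset n → Subset n → Set
Crosses A C = ¬ Nested A C

-- A set of separations: a (decidable) set of sides; the separation
-- {A, ∁A} lies in S iff one of its sides is marked.
SepSet : ℕ → Set
SepSet n = Subset n → Bool

Mem : {n : ℕ} → SepSet n → Subset n → Set
Mem S A = S A ≡ true ⊎ S (∁ A) ≡ true

HasCard : {n : ℕ} → (Subset n → Set) → ℕ → Set
HasCard {n} P k =
  Σ (List (Subset n)) λ xs →
    Unique xs × (∀ C → (P C → C L.∈ xs) × (C L.∈ xs → P C)) × length xs ≡ k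

module _ {n : ℕ} (M : Matroid n) where

  -- Entanglements.  Since A ranges over both sides of r = {A, ∁A}, the
  -- side X of r is A; the two corners on that side are A ∩ C and A ∩ ∁C
  -- (their other sides are the complements).
  record IsEntanglement (ε : SepSet n) : Set where
    field
      nonempty : ∃ λ A → Mem ε A
      closure  : ∀ A C → Mem ε A → Crosses A C →
                 order M (A ∩ C) ≤ order M A →
                 order M (A ∩ ∁ C) ≤ order M A →
                 (order M (A ∩ C) ≡ order M A × Mem ε (A ∩ C))
                 ⊎ (order M (A ∩ ∁ C) ≡ order M A × Mem ε (A ∩ ∁ C))

  InSomeEntanglement : Subset n → Set
  InSomeEntanglement C = ∃ λ (ε : SepSet n) → IsEntanglement ε × Mem ε C

  -- Separations lying in entanglements that cross {A, ∁A}; each such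
  -- separation is counted via both its sides (a factor 2, harmless for
  -- comparisons).
  Crossers : Subset n → Subset n → Set
  Crossers A C = InSomeEntanglement C × Crosses A C

  CrossesFewer : Subset n → Subset n → Set
  CrossesFewer T S = ∃ λ a → ∃ λ b →
    HasCard (Crossers T) a × HasCard (Crossers S) b × a < b

  Friendly : Subset n → Set
  Friendly S = ∃ λ (ε : SepSet n) → IsEntanglement ε × Mem ε S ×
    (∀ T → Mem ε T → ¬ CrossesFewer T S)

  -- Tangles of order k; (A, ∁A) ∈ τ is encoded as τ A ≡ true.
  record Tangle : Set where
    field
      k         : ℕ
      τ         : Subset n → Bool
      τ-order   : ∀ A → τ A ≡ true → order M A < k
      exactlyOne : ∀ A → order M A < k →
                   (τ A ≡ true × τ (∁ A) ≡ false) ⊎ (τ A ≡ false × τ (∁ A) ≡ true)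
      noCover   : ∀ A₁ A₂ A₃ → τ A₁ ≡ true → τ A₂ ≡ true → τ A₃ ≡ true →
                  (A₁ ∪ A₂) ∪ A₃ ≢ ⊤

  open Tangle

  Distinguishes : Subset n → Tangle → Tangle → Set
  Distinguishes A t t' = (τ t A ≡ true × τ t' (∁ A) ≡ true)
                       ⊎ (τ t (∁ A) ≡ true × τ t' A ≡ true)

  EfficientlyDistinguishes : Subset n → Tangle → Tangle → Set
  EfficientlyDistinguishes A t t' =
    Distinguishes A t t' × (∀ C → Distinguishes C t t' → order M A ≤ order M C)

  Distinguishable : Tangle → Tangle → Set
  Distinguishable t t' = ∃ λ A → Distinguishes A t t'

-- Trees: vertices Fin (suc m), vertex 0 is the root, and vertex (suc i)
-- has parent (parent i) of smaller index.  Every finite tree arises so.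
-- The edges are indexed by i : Fin m (edge between suc i and parent i).

record TreeDecomposition (n : ℕ) : Set where
  field
    m        : ℕ
    parent   : Fin m → Fin (suc m)
    parent-< : ∀ i → toℕ (parent i) ≤ toℕ i
    φ        : Fin n → Fin (suc m)

  data Below (v : Fin (suc m)) : Fin (suc m) → Set where
    here : Below v v
    step : ∀ j → Below v (parent j) → Below v (suc j)

  -- A is a side of the separation induced by edge i: the elements mapped
  -- into the component of T - i containing suc i.
  EdgeSep : Fin m → Subset n → Set
  EdgeSep i A = ∀ x → (x ∈ A → Below (suc i) (φ x)) × (Below (suc i) (φ x) → x ∈ A)

module _ {n : ℕ} (M : Matroid n) where
  open TreeDecomposition

  TDEfficientlyDistinguishes : TreeDecomposition n → Tangle M → Tangle M → Set
  TDEfficientlyDistinguishes T t t' =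
    ∃ λ i → ∃ λ A → EdgeSep T i A × EfficientlyDistinguishes M A t t'

-- If friendly separations {A, ∁A} and {C, ∁C} crossed, then on each of the
-- four sides whose two corners both have order at most that of the side, one
-- corner would have the same order and cross at least as many separations
-- lying in entanglements (closure of the entanglement plus minimality of the
-- friendly separation).  Submodularity bounds the orders of two opposite
-- corners by |A| + |C|; and a separation crossing a corner crosses A or C, one
-- crossing both opposite corners crosses A and C, while C crosses A but no
-- corner, so two opposite corners together cross fewer separations than A and
-- C.  These inequalities are arithmetically incompatible.  For distinguishable
-- tangles the efficient distinguishers form an entanglement, by the usual
-- corner argument, and a member crossing fewest separations is a friendly
-- efficient distinguisher.  The sides of friendly separations avoiding a fixed
-- element form a laminar family, which is the family of edge separations of
-- the tree in which every set hangs below the smallest set strictly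
-- containing it.
module Submission where

open import Defs
open import Algebra.Lattice.Properties.BooleanAlgebra as BooleanAlgebraProperties using ()
open import Data.Bool using (true)
open import Data.Bool.Properties using () renaming (_≟_ to _≟ᵇ_)
open import Data.Empty using (⊥; ⊥-elim)
open import Data.Fin using (Fin; zero; suc; toℕ)
open import Data.Fin.Properties using (any?; toℕ-injective) renaming (_≟_ to _≟ᶠ_)
open import Data.Fin.Subset hiding (⊥)
open import Data.Fin.Subset.Properties
open import Data.List as List using (List; []; _∷_; _++_; map; filter; length)
open import Data.List.Extrema.Nat using (argmin; argmin-all; f[argmin]≤f[xs])
open import Data.List.Membership.Propositional using () renaming (_∈_ to _∈ₗ_)
open import Data.List.Membership.Propositional.Properties
  using (∈-++⁺ˡ; ∈-++⁺ʳ; ∈-map⁺; ∈-filter⁺; ∈-filter⁻; ∈-allFin; ∈-lookup)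
open import Data.List.Membership.Propositional.Properties.WithK using (unique∧set⇒bag)
open import Data.List.Relation.Binary.BagAndSetEquality using (∼bag⇒↭)
open import Data.List.Relation.Binary.Permutation.Propositional.Properties using (↭-length)
open import Data.List.Relation.Unary.All as All using (All; []; _∷_)
import Data.List.Relation.Unary.All.Properties as All
open import Data.List.Relation.Unary.AllPairs as AllPairs using (AllPairs; []; _∷_)
import Data.List.Relation.Unary.AllPairs.Properties as AllPairs
open import Data.List.Relation.Unary.Any as Any using () renaming (here to hereₗ; there to thereₗ)
open import Data.List.Relation.Unary.Any.Properties using (lookup-index)
open import Data.List.Relation.Unary.Unique.Propositional using (Unique)
open import Data.Nat using (ℕ; zero; suc; _+_; _∸_; _≤_; _<_; z≤n; s≤s; _≤?_; _<?_)
open import Data.Nat.Induction using (<-wellFounded)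
open import Data.Nat.Properties
open import Algebra.Properties.CommutativeSemigroup +-commutativeSemigroup using (interchange)
open import Data.Product using (Σ; ∃; _×_; _,_; proj₁; proj₂; map₂)
open import Data.Sum as Sum using (_⊎_; inj₁; inj₂)
import Data.Vec as Vec
open import Data.Vec using ([]; _∷_)
open import Data.Vec.Properties using (lookup∘tabulate)
open import Function using (_∘_)
open import Function.Bundles using (mk⇔)
open import Induction.WellFounded using (Acc; acc)
open import Relation.Binary.Definitions using (tri<; tri≈; tri>)
open import Relation.Binary.PropositionalEquality
open import Relation.Nullary
open import Relation.Nullary.Decidable
  using (_⊎-dec_; _×-dec_; _→-dec_; map′; decidable-stable; dec-true)
open import Relation.Unary using (Decidable)

private
  variable
    n m o r : ℕ
    A C D X Y : Subset n
    a c p q u v kA kC kp kq ku kv : ℕ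

-- Finite enumeration and counting

allSubsets : (n : ℕ) → List (Subset n)
allSubsets zero    = [] ∷ []
allSubsets (suc n) = map (inside ∷_) (allSubsets n) ++ map (outside ∷_) (allSubsets n)

∈-allSubsets : (X : Subset n) → X ∈ₗ allSubsets n
∈-allSubsets []                    = hereₗ refl
∈-allSubsets (inside ∷ X)          = ∈-++⁺ˡ (∈-map⁺ (inside ∷_) (∈-allSubsets X))
∈-allSubsets {suc n} (outside ∷ X) =
  ∈-++⁺ʳ (map (inside ∷_) (allSubsets n)) (∈-map⁺ (outside ∷_) (∈-allSubsets X))

allSubsets-⊈ : ∀ n → AllPairs (λ X Y → ¬ X ⊆ Y) (allSubsets n)
allSubsets-⊈ zero    = [] ∷ []
allSubsets-⊈ (suc n) =
  AllPairs.++⁺ (AllPairs.map⁺ (AllPairs.map ⊈-∷ (allSubsets-⊈ n)))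
               (AllPairs.map⁺ (AllPairs.map ⊈-∷ (allSubsets-⊈ n)))
               (All.map⁺ (All.tabulate λ _ → All.map⁺ (All.tabulate λ _ → inside⊈outside)))
  where
  ⊈-∷ : ∀ {s} {X Y : Subset n} → ¬ X ⊆ Y → ¬ s ∷ X ⊆ s ∷ Y
  ⊈-∷ X⊈Y = X⊈Y ∘ drop-∷-⊆
  inside⊈outside : {X Y : Subset n} → ¬ inside ∷ X ⊆ outside ∷ Y
  inside⊈outside X⊆Y with X⊆Y Vec.here
  ... | ()

allSubsets-unique : ∀ n → Unique (allSubsets n)
allSubsets-unique n = AllPairs.map (λ X⊈Y X≡Y → X⊈Y (⊆-reflexive X≡Y)) (allSubsets-⊈ n)

∀-Subset? : {P : Subset n → Set} → Decidable P → Dec (∀ X → P X)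
∀-Subset? P? with anySubset? (¬? ∘ P?)
... | yes (X , ¬PX) = no λ ∀P → ¬PX (∀P X)
... | no ∄¬P        = yes λ X → decidable-stable (P? X) (λ ¬PX → ∄¬P (X , ¬PX))

minimiser : {I : Set} {xs : List I} → (∀ x → x ∈ₗ xs) →
            {P : I → Set} → Decidable P → (g : I → ℕ) → ∀ {x} → P x →
            ∃ λ z → P z × (∀ y → P y → g z ≤ g y)
minimiser {I} {xs} complete P? g {x} Px =
  argmin g x candidates , argmin-all g Px (All.all-filter P? xs) ,
  λ y Py → All.lookup (f[argmin]≤f[xs] x candidates) (∈-filter⁺ P? (complete y) Py)
  where
  candidates : List I
  candidates = filter P? xs

-- A set of separations only matters through its values on the list of all
-- subsets, so it is coded by a subset of positions in that list.
module _ {n : ℕ} where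
  private
    K : ℕ
    K = length (allSubsets n)

  decodeSepSet : Subset K → SepSet n
  decodeSepSet v X = Vec.lookup v (Any.index (∈-allSubsets X))

  encodeSepSet : SepSet n → Subset K
  encodeSepSet ε = Vec.tabulate (ε ∘ List.lookup (allSubsets n))

  decode-encode : ∀ ε X → decodeSepSet (encodeSepSet ε) X ≡ ε X
  decode-encode ε X = trans (lookup∘tabulate (ε ∘ List.lookup (allSubsets n)) _)
                            (cong ε (sym (lookup-index (∈-allSubsets X))))

  anySepSet? : {P : SepSet n → Set} → (∀ {ε ε'} → (∀ X → ε X ≡ ε' X) → P ε → P ε') →
               Decidable P → Dec (∃ P)
  anySepSet? ext P? =
    map′ (λ (v , Pv) → decodeSepSet v , Pv)
         (λ (ε , Pε) → encodeSepSet ε , ext (λ X → sym (decode-encode ε X)) Pε)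
         (anySubset? (P? ∘ decodeSepSet))

does⇒witness : {P : Set} (P? : Dec P) → does P? ≡ true → P
does⇒witness (yes p) _ = p
does⇒witness (no _)  ()

AllPairs-lookup : ∀ {I : Set} {R : I → I → Set} {xs : List I} → AllPairs R xs →
                  ∀ i j → toℕ i < toℕ j → R (List.lookup xs i) (List.lookup xs j)
AllPairs-lookup (Rx ∷ _)  zero    (suc j) _         = All.lookup Rx (∈-lookup j)
AllPairs-lookup (_ ∷ Rxs) (suc i) (suc j) (s≤s i<j) = AllPairs-lookup Rxs i j i<j

q⊆p⇒∣p∣≤∣q∣⇒p⊆q : {p q : Subset n} → q ⊆ p → ∣ p ∣ ≤ ∣ q ∣ → p ⊆ q
q⊆p⇒∣p∣≤∣q∣⇒p⊆q {q = q} q⊆p ∣p∣≤∣q∣ {x} x∈p =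
  decidable-stable (x ∈? q) λ x∉q → <⇒≱ (p⊂q⇒∣p∣<∣q∣ (q⊆p , x , x∈p , x∉q)) ∣p∣≤∣q∣

HasCard-unique : ∀ {P : Subset n → Set} {k l} → HasCard P k → HasCard P l → k ≡ l
HasCard-unique (xs , xs! , xs≐P , refl) (ys , ys! , ys≐P , refl) =
  ↭-length (∼bag⇒↭ (unique∧set⇒bag xs! ys! λ {X} →
    mk⇔ (proj₁ (ys≐P X) ∘ proj₂ (xs≐P X)) (proj₁ (xs≐P X) ∘ proj₂ (ys≐P X))))

indicator : {P : Set} → Dec P → ℕ
indicator (yes _) = 1
indicator (no _)  = 0

indicator-cong : {P Q : Set} (P? : Dec P) (Q? : Dec Q) → (P → Q) → (Q → P) →
                 indicator P? ≡ indicator Q?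
indicator-cong (yes _) (yes _) _   _   = refl
indicator-cong (no _)  (no _)  _   _   = refl
indicator-cong (yes p) (no ¬q) P⇒Q _   = contradiction (P⇒Q p) ¬q
indicator-cong (no ¬p) (yes q) _   Q⇒P = contradiction (Q⇒P q) ¬p

indicator-⊎ : {R S : Set} (R? : Dec R) (S? : Dec S) → R ⊎ S → 1 ≤ indicator R? + indicator S?
indicator-⊎ (yes _) _       _        = s≤s z≤n
indicator-⊎ (no _)  (yes _) _        = s≤s z≤n
indicator-⊎ (no ¬r) (no _)  (inj₁ r) = contradiction r ¬r
indicator-⊎ (no _)  (no ¬s) (inj₂ s) = contradiction s ¬s

indicator-+-≤ : {P Q R S : Set} (P? : Dec P) (Q? : Dec Q) (R? : Dec R) (S? : Dec S) →
                (P → R ⊎ S) → (Q → R ⊎ S) → (P → Q → R × S) →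
                indicator P? + indicator Q? ≤ indicator R? + indicator S?
indicator-+-≤ (no _)  (no _)  _       _       _  _  _    = z≤n
indicator-+-≤ (yes p) (no _)  R?      S?      P⇒ _  _    = indicator-⊎ R? S? (P⇒ p)
indicator-+-≤ (no _)  (yes q) R?      S?      _  Q⇒ _    = indicator-⊎ R? S? (Q⇒ q)
indicator-+-≤ (yes _) (yes _) (yes _) (yes _) _  _  _    = ≤-refl
indicator-+-≤ (yes p) (yes q) (no ¬r) _       _  _  both = contradiction (proj₁ (both p q)) ¬r
indicator-+-≤ (yes p) (yes q) (yes _) (no ¬s) _  _  both = contradiction (proj₂ (both p q)) ¬s

indicator-+-< : {P Q R S : Set} (P? : Dec P) (Q? : Dec Q) (R? : Dec R) (S? : Dec S) →
                ¬ P → ¬ Q → R → indicator P? + indicator Q? < indicator R? + indicator S?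
indicator-+-< (yes p) _       _       _ ¬p _  _ = contradiction p ¬p
indicator-+-< (no _)  (yes q) _       _ _  ¬q _ = contradiction q ¬q
indicator-+-< (no _)  (no _)  (no ¬r) _ _  _  r = contradiction r ¬r
indicator-+-< (no _)  (no _)  (yes _) _ _  _  _ = s≤s z≤n

∑ : {I : Set} → List I → (I → ℕ) → ℕ
∑ []       f = 0
∑ (x ∷ xs) f = f x + ∑ xs f

module _ {I : Set} where

  ∑-+ : ∀ (xs : List I) f g → ∑ xs (λ x → f x + g x) ≡ ∑ xs f + ∑ xs g
  ∑-+ []       f g = refl
  ∑-+ (x ∷ xs) f g = trans (cong (f x + g x +_) (∑-+ xs f g)) (interchange (f x) (g x) _ _)

  ∑-cong : ∀ (xs : List I) {f g} → (∀ x → f x ≡ g x) → ∑ xs f ≡ ∑ xs g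
  ∑-cong []       f≗g = refl
  ∑-cong (x ∷ xs) f≗g = cong₂ _+_ (f≗g x) (∑-cong xs f≗g)

  ∑-mono-≤ : ∀ (xs : List I) {f g} → (∀ x → f x ≤ g x) → ∑ xs f ≤ ∑ xs g
  ∑-mono-≤ []       f≤g = z≤n
  ∑-mono-≤ (x ∷ xs) f≤g = +-mono-≤ (f≤g x) (∑-mono-≤ xs f≤g)

  ∑-mono-< : ∀ {xs : List I} {f g} → (∀ x → f x ≤ g x) → ∀ {y} → y ∈ₗ xs → f y < g y →
             ∑ xs f < ∑ xs g
  ∑-mono-< {x ∷ xs} f≤g (hereₗ refl)  fy<gy = +-mono-<-≤ fy<gy (∑-mono-≤ xs f≤g)
  ∑-mono-< {x ∷ xs} f≤g (thereₗ y∈xs) fy<gy = +-mono-≤-< (f≤g x) (∑-mono-< f≤g y∈xs fy<gy)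

  length-filter≡∑ : ∀ {P : I → Set} (P? : Decidable P) xs →
                    length (filter P? xs) ≡ ∑ xs (indicator ∘ P?)
  length-filter≡∑ P? [] = refl
  length-filter≡∑ P? (x ∷ xs) with P? x
  ... | yes _ = cong suc (length-filter≡∑ P? xs)
  ... | no _  = length-filter≡∑ P? xs

-- Nested and crossing separations

module _ {n : ℕ} where
  open BooleanAlgebraProperties (∪-∩-booleanAlgebra n) public
    using () renaming (¬-involutive to ∁-involutive; deMorgan₁ to ∁-∩; ¬⊥≈⊤ to ∁∅≡⊤)

Nested⊆ : Subset n → Subset n → Set
Nested⊆ A C = A ⊆ C ⊎ A ⊆ ∁ C ⊎ ∁ A ⊆ C ⊎ ∁ A ⊆ ∁ C

Nested⊆⇒Nested : Nested⊆ A C → Nested A C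
Nested⊆⇒Nested (inj₁ h)               = inj₁ (h , p⊆q⇒∁p⊇∁q h)
Nested⊆⇒Nested (inj₂ (inj₁ h))        = inj₂ (inj₁ (h , p⊆q⇒∁p⊇∁q h))
Nested⊆⇒Nested (inj₂ (inj₂ (inj₁ h))) = inj₂ (inj₂ (inj₁ (h , p⊆q⇒∁p⊇∁q h)))
Nested⊆⇒Nested (inj₂ (inj₂ (inj₂ h))) = inj₂ (inj₂ (inj₂ (h , p⊆q⇒∁p⊇∁q h)))

Nested⇒Nested⊆ : Nested A C → Nested⊆ A C
Nested⇒Nested⊆ (inj₁ (h , _))               = inj₁ h
Nested⇒Nested⊆ (inj₂ (inj₁ (h , _)))        = inj₂ (inj₁ h)
Nested⇒Nested⊆ (inj₂ (inj₂ (inj₁ (h , _)))) = inj₂ (inj₂ (inj₁ h))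
Nested⇒Nested⊆ (inj₂ (inj₂ (inj₂ (h , _)))) = inj₂ (inj₂ (inj₂ h))

nested? : (A C : Subset n) → Dec (Nested A C)
nested? A C = map′ Nested⊆⇒Nested Nested⇒Nested⊆
  ((A ⊆? C) ⊎-dec (A ⊆? ∁ C) ⊎-dec (∁ A ⊆? C) ⊎-dec (∁ A ⊆? ∁ C))

p⊆∁q⇒q⊆∁p : {p q : Subset n} → p ⊆ ∁ q → q ⊆ ∁ p
p⊆∁q⇒q⊆∁p p⊆∁q x∈q = x∉p⇒x∈∁p λ x∈p → x∈∁p⇒x∉p (p⊆∁q x∈p) x∈q

∁p⊆q⇒∁q⊆p : {p q : Subset n} → ∁ p ⊆ q → ∁ q ⊆ p
∁p⊆q⇒∁q⊆p ∁p⊆q x∈∁q = x∉∁p⇒x∈p λ x∈∁p → x∈∁p⇒x∉p x∈∁q (∁p⊆q x∈∁p)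

∁p⊆∁[p∩q] : (p q : Subset n) → ∁ p ⊆ ∁ (p ∩ q)
∁p⊆∁[p∩q] p q = p⊆q⇒∁p⊇∁q (p∩q⊆p p q)

p⊆∁[∁p∩q] : (p q : Subset n) → p ⊆ ∁ (∁ p ∩ q)
p⊆∁[∁p∩q] p q = subst (_⊆ ∁ (∁ p ∩ q)) (∁-involutive p) (∁p⊆∁[p∩q] (∁ p) q)

Nested⊆-sym : Nested⊆ A C → Nested⊆ C A
Nested⊆-sym (inj₁ h)               = inj₂ (inj₂ (inj₂ (p⊆q⇒∁p⊇∁q h)))
Nested⊆-sym (inj₂ (inj₁ h))        = inj₂ (inj₁ (p⊆∁q⇒q⊆∁p h))
Nested⊆-sym (inj₂ (inj₂ (inj₁ h))) = inj₂ (inj₂ (inj₁ (∁p⊆q⇒∁q⊆p h)))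
Nested⊆-sym (inj₂ (inj₂ (inj₂ h))) = inj₁ (∁p⊆∁q⇒p⊇q h)

Nested⊆-∁ʳ : Nested⊆ A C → Nested⊆ A (∁ C)
Nested⊆-∁ʳ {C = C} (inj₁ h) =
  inj₂ (inj₁ (subst (_ ⊆_) (sym (∁-involutive C)) h))
Nested⊆-∁ʳ (inj₂ (inj₁ h)) = inj₁ h
Nested⊆-∁ʳ {C = C} (inj₂ (inj₂ (inj₁ h))) =
  inj₂ (inj₂ (inj₂ (subst (_ ⊆_) (sym (∁-involutive C)) h)))
Nested⊆-∁ʳ (inj₂ (inj₂ (inj₂ h))) = inj₂ (inj₂ (inj₁ h))

Nested-sym : Nested A C → Nested C A
Nested-sym = Nested⊆⇒Nested ∘ Nested⊆-sym ∘ Nested⇒Nested⊆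

Nested-∁ʳ : Nested A C → Nested A (∁ C)
Nested-∁ʳ = Nested⊆⇒Nested ∘ Nested⊆-∁ʳ ∘ Nested⇒Nested⊆

Nested-∁ˡ : Nested A C → Nested (∁ A) C
Nested-∁ˡ = Nested-sym ∘ Nested-∁ʳ ∘ Nested-sym

Crosses-sym : Crosses A C → Crosses C A
Crosses-sym A⋔C = A⋔C ∘ Nested-sym

Crosses-∁ˡ⁻ : Crosses (∁ A) C → Crosses A C
Crosses-∁ˡ⁻ ∁A⋔C = ∁A⋔C ∘ Nested-∁ˡ

Crosses-∁ˡ : Crosses A C → Crosses (∁ A) C
Crosses-∁ˡ {A = A} {C} A⋔C = A⋔C ∘ subst (λ Z → Nested Z C) (∁-involutive A) ∘ Nested-∁ˡ

Crosses-∁ʳ : Crosses A C → Crosses A (∁ C)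
Crosses-∁ʳ {A = A} {C} A⋔C = A⋔C ∘ subst (Nested A) (∁-involutive C) ∘ Nested-∁ʳ

Nested⊆-∩ : Crosses A C → Nested⊆ D A → Nested⊆ D C → Nested⊆ D (A ∩ C)
Nested⊆-∩ {A = A} {C} _ (inj₂ (inj₁ D⊆∁A)) _ =
  inj₂ (inj₁ (⊆-trans D⊆∁A (∁p⊆∁[p∩q] A C)))
Nested⊆-∩ {A = A} {C} _ (inj₂ (inj₂ (inj₂ ∁D⊆∁A))) _ =
  inj₂ (inj₂ (inj₂ (⊆-trans ∁D⊆∁A (∁p⊆∁[p∩q] A C))))
Nested⊆-∩ {A = A} {C} _ _ (inj₂ (inj₁ D⊆∁C)) =
  inj₂ (inj₁ (subst (λ Z → _ ⊆ ∁ Z) (∩-comm C A) (⊆-trans D⊆∁C (∁p⊆∁[p∩q] C A))))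
Nested⊆-∩ {A = A} {C} _ _ (inj₂ (inj₂ (inj₂ ∁D⊆∁C))) =
  inj₂ (inj₂ (inj₂ (subst (λ Z → _ ⊆ ∁ Z) (∩-comm C A) (⊆-trans ∁D⊆∁C (∁p⊆∁[p∩q] C A)))))
Nested⊆-∩ _ (inj₁ D⊆A) (inj₁ D⊆C) = inj₁ λ x∈D → x∈p∩q⁺ (D⊆A x∈D , D⊆C x∈D)
Nested⊆-∩ _ (inj₂ (inj₂ (inj₁ ∁D⊆A))) (inj₂ (inj₂ (inj₁ ∁D⊆C))) =
  inj₂ (inj₂ (inj₁ λ x∈∁D → x∈p∩q⁺ (∁D⊆A x∈∁D , ∁D⊆C x∈∁D)))
Nested⊆-∩ A⋔C (inj₁ D⊆A) (inj₂ (inj₂ (inj₁ ∁D⊆C))) =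
  contradiction (Nested⊆⇒Nested (inj₂ (inj₂ (inj₁ (⊆-trans (p⊆q⇒∁p⊇∁q D⊆A) ∁D⊆C))))) A⋔C
Nested⊆-∩ A⋔C (inj₂ (inj₂ (inj₁ ∁D⊆A))) (inj₁ D⊆C) =
  contradiction (Nested⊆⇒Nested (inj₂ (inj₂ (inj₁ (⊆-trans (∁p⊆q⇒∁q⊆p ∁D⊆A) D⊆C))))) A⋔C

Nested⊆-opposite-corners : Nested⊆ D A → Nested⊆ D (A ∩ C) ⊎ Nested⊆ D (∁ A ∩ ∁ C)
Nested⊆-opposite-corners {A = A} {C = C} (inj₁ D⊆A) =
  inj₂ (inj₂ (inj₁ (⊆-trans D⊆A (p⊆∁[∁p∩q] A (∁ C)))))
Nested⊆-opposite-corners {A = A} {C = C} (inj₂ (inj₁ D⊆∁A)) =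
  inj₁ (inj₂ (inj₁ (⊆-trans D⊆∁A (∁p⊆∁[p∩q] A C))))
Nested⊆-opposite-corners {A = A} {C = C} (inj₂ (inj₂ (inj₁ ∁D⊆A))) =
  inj₂ (inj₂ (inj₂ (inj₂ (⊆-trans ∁D⊆A (p⊆∁[∁p∩q] A (∁ C))))))
Nested⊆-opposite-corners {A = A} {C = C} (inj₂ (inj₂ (inj₂ ∁D⊆∁A))) =
  inj₁ (inj₂ (inj₂ (inj₂ (⊆-trans ∁D⊆∁A (∁p⊆∁[p∩q] A C)))))

Crosses-∩ : Crosses A C → Crosses (A ∩ C) D → Crosses A D ⊎ Crosses C D
Crosses-∩ {A = A} {C} {D} A⋔C A∩C⋔D with nested? A D | nested? C D
... | no A⋔D  | _       = inj₁ A⋔D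
... | yes _   | no C⋔D  = inj₂ C⋔D
... | yes A∥D | yes C∥D = contradiction
  (Nested-sym (Nested⊆⇒Nested (Nested⊆-∩ A⋔C (Nested⇒Nested⊆ (Nested-sym A∥D))
                                             (Nested⇒Nested⊆ (Nested-sym C∥D)))))
  A∩C⋔D

Crosses-opposite-corners : Crosses (A ∩ C) D → Crosses (∁ A ∩ ∁ C) D → Crosses A D × Crosses C D
Crosses-opposite-corners {A = A} {C} {D} A∩C⋔D ∁A∩∁C⋔D = A⋔D , C⋔D
  where
  nested-with-a-corner : Nested⊆ D (A ∩ C) ⊎ Nested⊆ D (∁ A ∩ ∁ C) → ⊥
  nested-with-a-corner (inj₁ D∥A∩C)   = A∩C⋔D (Nested-sym (Nested⊆⇒Nested D∥A∩C))
  nested-with-a-corner (inj₂ D∥∁A∩∁C) = ∁A∩∁C⋔D (Nested-sym (Nested⊆⇒Nested D∥∁A∩∁C))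
  A⋔D : Crosses A D
  A⋔D = nested-with-a-corner ∘ Nested⊆-opposite-corners ∘ Nested⇒Nested⊆ ∘ Nested-sym
  C⋔D : Crosses C D
  C⋔D = nested-with-a-corner
      ∘ Sum.map (subst (Nested⊆ D) (∩-comm C A)) (subst (Nested⊆ D) (∩-comm (∁ C) (∁ A)))
      ∘ Nested⊆-opposite-corners ∘ Nested⇒Nested⊆ ∘ Nested-sym

p∩q∪p∩∁q∪∁p≡⊤ : (p q : Subset n) → ((p ∩ q) ∪ (p ∩ ∁ q)) ∪ ∁ p ≡ ⊤
p∩q∪p∩∁q∪∁p≡⊤ p q = begin
  ((p ∩ q) ∪ (p ∩ ∁ q)) ∪ ∁ p ≡⟨ cong (_∪ ∁ p) (∩-distribˡ-∪ p q (∁ q)) ⟨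
  (p ∩ (q ∪ ∁ q)) ∪ ∁ p       ≡⟨ cong (λ Z → (p ∩ Z) ∪ ∁ p) (∪-inverseʳ q) ⟩
  (p ∩ ⊤) ∪ ∁ p               ≡⟨ cong (_∪ ∁ p) (∩-identityʳ p) ⟩
  p ∪ ∁ p                     ≡⟨ ∪-inverseʳ p ⟩
  ⊤                           ∎
  where open ≡-Reasoning

p∪∁[p∩q]∪p≡⊤ : (p q : Subset n) → (p ∪ ∁ (p ∩ q)) ∪ p ≡ ⊤
p∪∁[p∩q]∪p≡⊤ p q = begin
  (p ∪ ∁ (p ∩ q)) ∪ p   ≡⟨ cong (λ Z → (p ∪ Z) ∪ p) (∁-∩ p q) ⟩
  (p ∪ (∁ p ∪ ∁ q)) ∪ p ≡⟨ cong (_∪ p) (∪-assoc p (∁ p) (∁ q)) ⟨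
  ((p ∪ ∁ p) ∪ ∁ q) ∪ p ≡⟨ cong (λ Z → (Z ∪ ∁ q) ∪ p) (∪-inverseʳ p) ⟩
  (⊤ ∪ ∁ q) ∪ p         ≡⟨ cong (_∪ p) (∪-zeroˡ (∁ q)) ⟩
  ⊤ ∪ p                 ≡⟨ ∪-zeroˡ p ⟩
  ⊤                     ∎
  where open ≡-Reasoning

-- The order function

module _ (M : Matroid n) where
  open Matroid M

  rank⊤≤rank+rank∁ : ∀ X → rank ⊤ ≤ rank X + rank (∁ X)
  rank⊤≤rank+rank∁ X = begin
    rank ⊤                          ≡⟨ cong rank (p∪∁p≡⊤ X) ⟨
    rank (X ∪ ∁ X)                  ≤⟨ m≤m+n _ _ ⟩
    rank (X ∪ ∁ X) + rank (X ∩ ∁ X) ≤⟨ rank-submod X (∁ X) ⟩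
    rank X + rank (∁ X)             ∎
    where open ≤-Reasoning

  order+rank⊤ : ∀ X → order M X + rank ⊤ ≡ rank X + rank (∁ X)
  order+rank⊤ X = m∸n+n≡m (rank⊤≤rank+rank∁ X)

  order-∁ : ∀ X → order M (∁ X) ≡ order M X
  order-∁ X = cong (_∸ rank ⊤) (begin
    rank (∁ X) + rank (∁ (∁ X)) ≡⟨ cong (λ Z → rank (∁ X) + rank Z) (∁-involutive X) ⟩
    rank (∁ X) + rank X         ≡⟨ +-comm (rank (∁ X)) (rank X) ⟩
    rank X + rank (∁ X)         ∎)
    where open ≡-Reasoning

  order-submodular : ∀ X Y → order M (X ∩ Y) + order M (∁ X ∩ ∁ Y) ≤ order M X + order M Y
  order-submodular X Y = +-cancelʳ-≤ (rank ⊤ + rank ⊤) _ _ (begin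
    order M (X ∩ Y) + order M (∁ X ∩ ∁ Y) + (rank ⊤ + rank ⊤)
      ≡⟨ interchange (order M (X ∩ Y)) _ (rank ⊤) _ ⟩
    (order M (X ∩ Y) + rank ⊤) + (order M (∁ X ∩ ∁ Y) + rank ⊤)
      ≡⟨ cong₂ _+_ (order+rank⊤ (X ∩ Y)) (order+rank⊤ (∁ X ∩ ∁ Y)) ⟩
    (rank (X ∩ Y) + rank (∁ (X ∩ Y))) + (rank (∁ X ∩ ∁ Y) + rank (∁ (∁ X ∩ ∁ Y)))
      ≡⟨ cong₂ (λ U V → (rank (X ∩ Y) + rank U) + (rank (∁ X ∩ ∁ Y) + rank V))
               (∁-∩ X Y) ∁[∁X∩∁Y]≡X∪Y ⟩
    (rank (X ∩ Y) + rank (∁ X ∪ ∁ Y)) + (rank (∁ X ∩ ∁ Y) + rank (X ∪ Y))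
      ≡⟨ cong (rank (X ∩ Y) + rank (∁ X ∪ ∁ Y) +_) (+-comm (rank (∁ X ∩ ∁ Y)) _) ⟩
    (rank (X ∩ Y) + rank (∁ X ∪ ∁ Y)) + (rank (X ∪ Y) + rank (∁ X ∩ ∁ Y))
      ≡⟨ interchange (rank (X ∩ Y)) _ _ _ ⟩
    (rank (X ∩ Y) + rank (X ∪ Y)) + (rank (∁ X ∪ ∁ Y) + rank (∁ X ∩ ∁ Y))
      ≤⟨ +-mono-≤ (subst (_≤ rank X + rank Y) (+-comm (rank (X ∪ Y)) _) (rank-submod X Y))
                  (rank-submod (∁ X) (∁ Y)) ⟩
    (rank X + rank Y) + (rank (∁ X) + rank (∁ Y))
      ≡⟨ interchange (rank X) _ _ _ ⟩
    (rank X + rank (∁ X)) + (rank Y + rank (∁ Y))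
      ≡⟨ cong₂ _+_ (order+rank⊤ X) (order+rank⊤ Y) ⟨
    (order M X + rank ⊤) + (order M Y + rank ⊤)
      ≡⟨ interchange (order M X) _ _ _ ⟩
    order M X + order M Y + (rank ⊤ + rank ⊤) ∎)
    where
    open ≤-Reasoning
    ∁[∁X∩∁Y]≡X∪Y : ∁ (∁ X ∩ ∁ Y) ≡ X ∪ Y
    ∁[∁X∩∁Y]≡X∪Y = trans (∁-∩ (∁ X) (∁ Y)) (cong₂ _∪_ (∁-involutive X) (∁-involutive Y))

  order-submodular′ : ∀ X Y → order M (X ∩ ∁ Y) + order M (∁ X ∩ Y) ≤ order M X + order M Y
  order-submodular′ X Y =
    subst₂ (λ Z k → order M (X ∩ ∁ Y) + order M (∁ X ∩ Z) ≤ order M X + k)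
           (∁-involutive Y) (order-∁ Y) (order-submodular X (∁ Y))

-- Arithmetic of two crossing friendly separations

private
  m+n<o+r⇒o≤m⇒n<r : m + n < o + r → o ≤ m → n < r
  m+n<o+r⇒o≤m⇒n<r lt o≤m = ≰⇒> λ r≤n → <⇒≱ lt (+-mono-≤ o≤m r≤n)

  m+n<o+r⇒r≤m⇒n<o : m + n < o + r → r ≤ m → n < o
  m+n<o+r⇒r≤m⇒n<o {m = m} {n} {o} {r} lt r≤m =
    ≰⇒> λ o≤n → <⇒≱ lt (subst (_≤ m + n) (+-comm r o) (+-mono-≤ r≤m o≤n))

  m+n≤o+r⇒m≡o⇒n≤r : m + n ≤ o + r → m ≡ o → n ≤ r
  m+n≤o+r⇒m≡o⇒n≤r le refl = +-cancelˡ-≤ _ _ _ le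

  m+n≤o+r⇒m≡r⇒n≤o : m + n ≤ o + r → m ≡ r → n ≤ o
  m+n≤o+r⇒m≡r⇒n≤o {m = m} {n} {o} {r} le = m+n≤o+r⇒m≡o⇒n≤r (subst (m + n ≤_) (+-comm o r) le)

  m+n≤o+r⇒o<m⇒n<r : m + n ≤ o + r → o < m → n < r
  m+n≤o+r⇒o<m⇒n<r le o<m = ≰⇒> λ r≤n → <⇒≱ (+-mono-<-≤ o<m r≤n) le

  m+n≤o+r⇒o<n⇒m<r : m + n ≤ o + r → o < n → m < r
  m+n≤o+r⇒o<n⇒m<r {m = m} {n} {o} {r} le = m+n≤o+r⇒o<m⇒n<r (subst (_≤ o + r) (+-comm m n) le)

  m+n≤o+r⇒r<m⇒n<o : m + n ≤ o + r → r < m → n < o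
  m+n≤o+r⇒r<m⇒n<o {m = m} {n} {o} {r} le = m+n≤o+r⇒o<m⇒n<r (subst (m + n ≤_) (+-comm o r) le)

-- The closure condition at a side of order a and crossing number k whose two
-- corners have orders x, y and crossing numbers kx, ky, for a member of an
-- entanglement crossing no more separations than any other member.
CornerClosed : (a k x y kx ky : ℕ) → Set
CornerClosed a k x y kx ky = x ≤ a → y ≤ a → (x ≡ a × k ≤ kx) ⊎ (y ≡ a × k ≤ ky)

CornerClosed-swap : ∀ {a k x y kx ky} → CornerClosed a k x y kx ky → CornerClosed a k y x ky kx
CornerClosed-swap closed y≤a x≤a = Sum.swap (closed x≤a y≤a)

-- a, c are the orders of crossing separations {A, ∁A}, {C, ∁C}; p, q, u, v
-- those of the corners A ∩ C, A ∩ ∁C, ∁A ∩ C, ∁A ∩ ∁C; the k's are the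
-- corresponding crossing numbers.
record CrossingCorners (a c p q u v kA kC kp kq ku kv : ℕ) : Set where
  field
    closedA  : CornerClosed a kA p q kp kq
    closed∁A : CornerClosed a kA u v ku kv
    closedC  : CornerClosed c kC p u kp ku
    closed∁C : CornerClosed c kC q v kq kv
    submod₁  : p + v ≤ a + c
    submod₂  : q + u ≤ a + c
    fewer₁   : kp + kv < kA + kC
    fewer₂   : kq + ku < kA + kC

module _ (h : CrossingCorners a c p q u v kA kC kp kq ku kv) where
  open CrossingCorners h

  swap-∁C : CrossingCorners a c q p v u kA kC kq kp kv ku
  swap-∁C = record
    { closedA = CornerClosed-swap closedA ; closed∁A = CornerClosed-swap closed∁A
    ; closedC = closed∁C ; closed∁C = closedC
    ; submod₁ = submod₂ ; submod₂ = submod₁ ; fewer₁ = fewer₂ ; fewer₂ = fewer₁ }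

  swap-∁A : CrossingCorners a c u v p q kA kC ku kv kp kq
  swap-∁A = record
    { closedA = closed∁A ; closed∁A = closedA
    ; closedC = CornerClosed-swap closedC ; closed∁C = CornerClosed-swap closed∁C
    ; submod₁ = subst (_≤ a + c) (+-comm q u) submod₂
    ; submod₂ = subst (_≤ a + c) (+-comm p v) submod₁
    ; fewer₁  = subst (_< kA + kC) (+-comm kq ku) fewer₂
    ; fewer₂  = subst (_< kA + kC) (+-comm kp kv) fewer₁ }

  transpose : CrossingCorners c a p u q v kC kA kp ku kq kv
  transpose = record
    { closedA = closedC ; closed∁A = closed∁C ; closedC = closedA ; closed∁C = closed∁A
    ; submod₁ = subst (p + v ≤_) (+-comm a c) submod₁
    ; submod₂ = subst₂ _≤_ (+-comm q u) (+-comm a c) submod₂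
    ; fewer₁  = subst (kp + kv <_) (+-comm kA kC) fewer₁
    ; fewer₂  = subst₂ _<_ (+-comm kq ku) (+-comm kA kC) fewer₂ }

  module _ (a≤c : a ≤ c) where

    tight-corner-impossible : p ≤ a → q ≤ a → p ≡ a → kA ≤ kp → ⊥
    tight-corner-impossible p≤a q≤a p≡a kA≤kp =
      Sum.[ q-tight , (λ (_ , kC≤kv) → <⇒≱ kv<kC kC≤kv) ] (closed∁C (≤-trans q≤a a≤c) v≤c)
      where
      v≤c : v ≤ c
      v≤c = m+n≤o+r⇒m≡o⇒n≤r submod₁ p≡a
      kv<kC : kv < kC
      kv<kC = m+n<o+r⇒o≤m⇒n<r fewer₁ kA≤kp
      q-tight : q ≡ c × kC ≤ kq → ⊥
      q-tight (q≡c , kC≤kq) =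
        Sum.[ (λ (_ , kA≤ku) → <⇒≱ ku<kA kA≤ku) , v-tight ]
          (closed∁A u≤a (subst (v ≤_) (sym a≡c) v≤c))
        where
        a≡c : a ≡ c
        a≡c = ≤-antisym a≤c (subst (_≤ a) q≡c q≤a)
        u≤a : u ≤ a
        u≤a = m+n≤o+r⇒m≡r⇒n≤o submod₂ q≡c
        ku<kA : ku < kA
        ku<kA = m+n<o+r⇒r≤m⇒n<o fewer₂ kC≤kq
        v-tight : v ≡ a × kA ≤ kv → ⊥
        v-tight (_ , kA≤kv) =
          Sum.[ (λ (_ , kC≤kp) →
                   <⇒≱ fewer₁ (subst (_≤ kp + kv) (+-comm kC kA) (+-mono-≤ kC≤kp kA≤kv)))
              , (λ (_ , kC≤ku) → <⇒≱ (<-≤-trans kv<kC (≤-trans kC≤ku (<⇒≤ ku<kA))) kA≤kv) ]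
            (closedC (≤-trans p≤a a≤c) (≤-trans u≤a a≤c))

    large-adjacent-corners-impossible : a < p → a < u → ⊥
    large-adjacent-corners-impossible a<p a<u =
      Sum.[ (λ (q≡c , _) → <-irrefl q≡c q<c) , (λ (v≡c , _) → <-irrefl v≡c v<c) ]
        (closed∁C (<⇒≤ q<c) (<⇒≤ v<c))
      where
      q<c : q < c
      q<c = m+n≤o+r⇒o<n⇒m<r submod₂ a<u
      v<c : v < c
      v<c = m+n≤o+r⇒o<m⇒n<r submod₁ a<p

    large-opposite-corners⇒u≤a : a < p → a < v → u ≤ a
    large-opposite-corners⇒u≤a a<p a<v with q ≤? c
    ... | no q≰c  = <⇒≤ (m+n≤o+r⇒r<m⇒n<o submod₂ (≰⇒> q≰c))
    ... | yes q≤c =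
      Sum.[ (λ (q≡c , _) → m+n≤o+r⇒m≡r⇒n≤o submod₂ q≡c)
          , (λ (v≡c , _) → ⊥-elim (<-irrefl v≡c v<c)) ]
        (closed∁C q≤c (<⇒≤ v<c))
      where
      v<c : v < c
      v<c = m+n≤o+r⇒o<m⇒n<r submod₁ a<p

    large-opposite-corners-impossible : a < p → a < v → ⊥
    large-opposite-corners-impossible a<p a<v =
      Sum.[ (λ (p≡c , _) → <-irrefl p≡c p<c)
          , (λ (u≡c , _) → <-asym p<c (≤-<-trans (subst (_≤ a) u≡c u≤a) a<p)) ]
        (closedC (<⇒≤ p<c) (≤-trans u≤a a≤c))
      where
      p<c : p < c
      p<c = m+n≤o+r⇒o<n⇒m<r submod₁ a<v
      u≤a : u ≤ a
      u≤a = large-opposite-corners⇒u≤a a<p a<v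

tight-side-impossible : CrossingCorners a c p q u v kA kC kp kq ku kv → a ≤ c → p ≤ a → q ≤ a → ⊥
tight-side-impossible h a≤c p≤a q≤a with CrossingCorners.closedA h p≤a q≤a
... | inj₁ (p≡a , kA≤kp) = tight-corner-impossible h a≤c p≤a q≤a p≡a kA≤kp
... | inj₂ (q≡a , kA≤kq) = tight-corner-impossible (swap-∁C h) a≤c q≤a p≤a q≡a kA≤kq

one-exceeds : ∀ {x y} → ¬ (x ≤ a × y ≤ a) → a < x ⊎ a < y
one-exceeds {a} {x} {y} ¬both with x ≤? a | y ≤? a
... | no x≰a  | _       = inj₁ (≰⇒> x≰a)
... | yes _   | no y≰a  = inj₂ (≰⇒> y≰a)
... | yes x≤a | yes y≤a = contradiction (x≤a , y≤a) ¬both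

crossing-corners-impossible-≤ : CrossingCorners a c p q u v kA kC kp kq ku kv → a ≤ c → ⊥
crossing-corners-impossible-≤ {a} {c} {p} {q} {u} {v} h a≤c
  with p ≤? a ×-dec q ≤? a | u ≤? a ×-dec v ≤? a
... | yes (p≤a , q≤a) | _                = tight-side-impossible h a≤c p≤a q≤a
... | no _            | yes (u≤a , v≤a)  = tight-side-impossible (swap-∁A h) a≤c u≤a v≤a
... | no ¬pq          | no ¬uv with one-exceeds ¬pq | one-exceeds ¬uv
...   | inj₁ a<p | inj₁ a<u = large-adjacent-corners-impossible h a≤c a<p a<u
...   | inj₁ a<p | inj₂ a<v = large-opposite-corners-impossible h a≤c a<p a<v
...   | inj₂ a<q | inj₂ a<v = large-adjacent-corners-impossible (swap-∁C h) a≤c a<q a<v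
...   | inj₂ a<q | inj₁ a<u = large-opposite-corners-impossible (swap-∁C h) a≤c a<q a<u

crossing-corners-impossible : ¬ CrossingCorners a c p q u v kA kC kp kq ku kv
crossing-corners-impossible {a} {c} h with ≤-total a c
... | inj₁ a≤c = crossing-corners-impossible-≤ h a≤c
... | inj₂ c≤a = crossing-corners-impossible-≤ (transpose h) c≤a

-- Entanglements, crossing numbers and friendly separations

mem? : (ε : SepSet n) → Decidable (Mem ε)
mem? ε A = (ε A ≟ᵇ true) ⊎-dec (ε (∁ A) ≟ᵇ true)

Mem-∁ : ∀ (ε : SepSet n) A → Mem ε A → Mem ε (∁ A)
Mem-∁ ε A (inj₁ εA)  = inj₂ (subst (λ Z → ε Z ≡ true) (sym (∁-involutive A)) εA)
Mem-∁ ε A (inj₂ ε∁A) = inj₁ ε∁A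

Mem-ext : ∀ {ε ε' : SepSet n} → (∀ X → ε X ≡ ε' X) → Mem ε A → Mem ε' A
Mem-ext {A = A} ε≗ε' (inj₁ εA)  = inj₁ (trans (sym (ε≗ε' A)) εA)
Mem-ext {A = A} ε≗ε' (inj₂ ε∁A) = inj₂ (trans (sym (ε≗ε' (∁ A))) ε∁A)

module _ (M : Matroid n) where

  IsEntanglement-ext : ∀ {ε ε' : SepSet n} → (∀ X → ε X ≡ ε' X) →
                       IsEntanglement M ε → IsEntanglement M ε'
  IsEntanglement-ext ε≗ε' ent = record
    { nonempty = map₂ (Mem-ext ε≗ε') nonempty
    ; closure  = λ A C A∈ε' A⋔C A∩C≤A A∩∁C≤A →
        Sum.map (map₂ (Mem-ext ε≗ε')) (map₂ (Mem-ext ε≗ε'))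
                (closure A C (Mem-ext (sym ∘ ε≗ε') A∈ε') A⋔C A∩C≤A A∩∁C≤A) }
    where open IsEntanglement ent

  isEntanglement? : (ε : SepSet n) → Dec (IsEntanglement M ε)
  isEntanglement? ε =
    map′ (λ (ne , cl) → record { nonempty = ne ; closure = cl })
         (λ ent → IsEntanglement.nonempty ent , IsEntanglement.closure ent)
         (anySubset? (mem? ε) ×-dec ∀-Subset? λ A → ∀-Subset? λ C →
            mem? ε A →-dec ¬? (nested? A C) →-dec
            order M (A ∩ C) ≤? order M A →-dec order M (A ∩ ∁ C) ≤? order M A →-dec
            ((order M (A ∩ C) ≟ order M A ×-dec mem? ε (A ∩ C)) ⊎-dec
             (order M (A ∩ ∁ C) ≟ order M A ×-dec mem? ε (A ∩ ∁ C))))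

  inSomeEntanglement? : Decidable (InSomeEntanglement M)
  inSomeEntanglement? C = anySepSet?
    (λ ε≗ε' (ent , C∈ε) → IsEntanglement-ext ε≗ε' ent , Mem-ext ε≗ε' C∈ε)
    (λ ε → isEntanglement? ε ×-dec mem? ε C)

  crossers? : (A : Subset n) → Decidable (Crossers M A)
  crossers? A D = inSomeEntanglement? D ×-dec ¬? (nested? A D)

  crossingNumber : Subset n → ℕ
  crossingNumber A = ∑ (allSubsets n) (indicator ∘ crossers? A)

  crossingNumber-HasCard : ∀ A → HasCard (Crossers M A) (crossingNumber A)
  crossingNumber-HasCard A =
    filter (crossers? A) (allSubsets n) ,
    AllPairs.filter⁺ (crossers? A) (allSubsets-unique n) ,
    (λ C → ∈-filter⁺ (crossers? A) (∈-allSubsets C) ,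
           proj₂ ∘ ∈-filter⁻ (crossers? A) {xs = allSubsets n}) ,
    length-filter≡∑ (crossers? A) (allSubsets n)

  CrossesFewer⇒< : ∀ {T S} → CrossesFewer M T S → crossingNumber T < crossingNumber S
  CrossesFewer⇒< {T} {S} (k , l , #T≡k , #S≡l , k<l) =
    subst₂ _<_ (HasCard-unique #T≡k (crossingNumber-HasCard T))
               (HasCard-unique #S≡l (crossingNumber-HasCard S)) k<l

  <⇒CrossesFewer : ∀ {T S} → crossingNumber T < crossingNumber S → CrossesFewer M T S
  <⇒CrossesFewer {T} {S} lt = _ , _ , crossingNumber-HasCard T , crossingNumber-HasCard S , lt

  friendly? : Decidable (Friendly M)
  friendly? S = anySepSet?
    (λ ε≗ε' (ent , S∈ε , S-min) →
       IsEntanglement-ext ε≗ε' ent , Mem-ext ε≗ε' S∈ε , λ T → S-min T ∘ Mem-ext (sym ∘ ε≗ε'))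
    (λ ε → isEntanglement? ε ×-dec mem? ε S ×-dec
           ∀-Subset? λ T → mem? ε T →-dec
             ¬? (map′ <⇒CrossesFewer CrossesFewer⇒< (crossingNumber T <? crossingNumber S)))

  crossingNumber-∁ : ∀ X → crossingNumber (∁ X) ≡ crossingNumber X
  crossingNumber-∁ X = ∑-cong (allSubsets n) λ D →
    indicator-cong (crossers? (∁ X) D) (crossers? X D) (map₂ Crosses-∁ˡ⁻) (map₂ Crosses-∁ˡ)

  crossingNumber-corners : Crosses A C → InSomeEntanglement M C →
    crossingNumber (A ∩ C) + crossingNumber (∁ A ∩ ∁ C) < crossingNumber A + crossingNumber C
  crossingNumber-corners {A = A} {C} A⋔C C∈ent = begin-strict
    crossingNumber (A ∩ C) + crossingNumber (∁ A ∩ ∁ C)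
      ≡⟨ ∑-+ (allSubsets n) (indicator ∘ crossers? (A ∩ C)) (indicator ∘ crossers? (∁ A ∩ ∁ C)) ⟨
    ∑ (allSubsets n) (λ D → indicator (crossers? (A ∩ C) D) + indicator (crossers? (∁ A ∩ ∁ C) D))
      <⟨ ∑-mono-< corner-crossers≤ (∈-allSubsets C) corners-cross-C-less ⟩
    ∑ (allSubsets n) (λ D → indicator (crossers? A D) + indicator (crossers? C D))
      ≡⟨ ∑-+ (allSubsets n) (indicator ∘ crossers? A) (indicator ∘ crossers? C) ⟩
    crossingNumber A + crossingNumber C ∎
    where
    open ≤-Reasoning
    corner-crossers≤ : ∀ D → indicator (crossers? (A ∩ C) D) + indicator (crossers? (∁ A ∩ ∁ C) D)
                           ≤ indicator (crossers? A D) + indicator (crossers? C D)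
    corner-crossers≤ D = indicator-+-≤ (crossers? (A ∩ C) D) (crossers? (∁ A ∩ ∁ C) D)
      (crossers? A D) (crossers? C D)
      (λ (D∈ent , A∩C⋔D) → Sum.map (D∈ent ,_) (D∈ent ,_) (Crosses-∩ A⋔C A∩C⋔D))
      (λ (D∈ent , ∁A∩∁C⋔D) → Sum.map (λ ∁A⋔D → D∈ent , Crosses-∁ˡ⁻ ∁A⋔D)
                                      (λ ∁C⋔D → D∈ent , Crosses-∁ˡ⁻ ∁C⋔D)
                                      (Crosses-∩ (Crosses-∁ʳ (Crosses-∁ˡ A⋔C)) ∁A∩∁C⋔D))
      (λ (D∈ent , A∩C⋔D) (_ , ∁A∩∁C⋔D) →
         let A⋔D , C⋔D = Crosses-opposite-corners A∩C⋔D ∁A∩∁C⋔D in (D∈ent , A⋔D) , (D∈ent , C⋔D))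
    corners-cross-C-less : indicator (crossers? (A ∩ C) C) + indicator (crossers? (∁ A ∩ ∁ C) C)
                         < indicator (crossers? A C) + indicator (crossers? C C)
    corners-cross-C-less = indicator-+-< (crossers? (A ∩ C) C) (crossers? (∁ A ∩ ∁ C) C)
      (crossers? A C) (crossers? C C)
      (λ (_ , A∩C⋔C) → A∩C⋔C (Nested⊆⇒Nested (inj₁ (p∩q⊆q A C))))
      (λ (_ , ∁A∩∁C⋔C) → ∁A∩∁C⋔C (Nested⊆⇒Nested (inj₂ (inj₁ (p∩q⊆q (∁ A) (∁ C))))))
      (C∈ent , A⋔C)

  crossingNumber-corners′ : Crosses A C → InSomeEntanglement M C →
    crossingNumber (A ∩ ∁ C) + crossingNumber (∁ A ∩ C) < crossingNumber A + crossingNumber C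
  crossingNumber-corners′ {A = A} {C} A⋔C (ε , ent , C∈ε) =
    subst₂ (λ Z k → crossingNumber (A ∩ ∁ C) + crossingNumber (∁ A ∩ Z) < crossingNumber A + k)
           (∁-involutive C) (crossingNumber-∁ C)
           (crossingNumber-corners (Crosses-∁ʳ A⋔C) (ε , ent , Mem-∁ ε C C∈ε))

  entanglement-CornerClosed : ∀ {ε X Y P Q a k} → IsEntanglement M ε → Mem ε X → Crosses X Y →
    (∀ T → Mem ε T → k ≤ crossingNumber T) → order M X ≡ a → X ∩ Y ≡ P → X ∩ ∁ Y ≡ Q →
    CornerClosed a k (order M P) (order M Q) (crossingNumber P) (crossingNumber Q)
  entanglement-CornerClosed ent X∈ε X⋔Y k≤ refl refl refl P≤X Q≤X =
    Sum.map (map₂ (k≤ _)) (map₂ (k≤ _)) (IsEntanglement.closure ent _ _ X∈ε X⋔Y P≤X Q≤X)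

  friendly⇒minimal : ∀ {S} ((ε , _) : Friendly M S) →
                     ∀ T → Mem ε T → crossingNumber S ≤ crossingNumber T
  friendly⇒minimal (_ , _ , _ , S-min) T T∈ε = ≮⇒≥ (S-min T T∈ε ∘ <⇒CrossesFewer)

  friendly-nested : ∀ A C → Friendly M A → Friendly M C → Nested A C
  friendly-nested A C A!@(ε , ε-ent , A∈ε , _) C!@(ε' , ε'-ent , C∈ε' , _) with nested? A C
  ... | yes A∥C = A∥C
  ... | no A⋔C  = ⊥-elim (crossing-corners-impossible record
    { closedA  = entanglement-CornerClosed ε-ent A∈ε A⋔C A-min refl refl refl
    ; closed∁A = entanglement-CornerClosed ε-ent (Mem-∁ ε A A∈ε) (Crosses-∁ˡ A⋔C) A-min
                                           (order-∁ M A) refl refl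
    ; closedC  = entanglement-CornerClosed ε'-ent C∈ε' C⋔A C-min refl (∩-comm C A) (∩-comm C (∁ A))
    ; closed∁C = entanglement-CornerClosed ε'-ent (Mem-∁ ε' C C∈ε') (Crosses-∁ˡ C⋔A) C-min
                                           (order-∁ M C) (∩-comm (∁ C) A) (∩-comm (∁ C) (∁ A))
    ; submod₁  = order-submodular M A C
    ; submod₂  = order-submodular′ M A C
    ; fewer₁   = crossingNumber-corners A⋔C (ε' , ε'-ent , C∈ε')
    ; fewer₂   = crossingNumber-corners′ A⋔C (ε' , ε'-ent , C∈ε') })
    where
    C⋔A : Crosses C A
    C⋔A = Crosses-sym A⋔C
    A-min : ∀ T → Mem ε T → crossingNumber A ≤ crossingNumber T
    A-min = friendly⇒minimal A!
    C-min : ∀ T → Mem ε' T → crossingNumber C ≤ crossingNumber T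
    C-min = friendly⇒minimal C!

  Friendly-∁ : Friendly M X → Friendly M (∁ X)
  Friendly-∁ {X = X} (ε , ent , X∈ε , X-min) =
    ε , ent , Mem-∁ ε X X∈ε , λ T T∈ε T<∁X →
      X-min T T∈ε (<⇒CrossesFewer (subst (_ <_) (crossingNumber-∁ X) (CrossesFewer⇒< T<∁X)))

-- Tangles and their efficient distinguishers

module _ {M : Matroid n} (t : Tangle M) where
  open Tangle t

  τ-orients : order M A < k → τ A ≡ true ⊎ τ (∁ A) ≡ true
  τ-orients {A = A} A<k = Sum.map proj₁ proj₂ (exactlyOne A A<k)

  ¬τ⊤ : τ ⊤ ≢ true
  ¬τ⊤ τ⊤ = noCover ⊤ ⊤ ⊤ τ⊤ τ⊤ τ⊤ (∪-zeroʳ (⊤ ∪ ⊤))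

  τ-∩ : τ A ≡ true → order M (A ∩ Y) ≤ order M A → τ (A ∩ Y) ≡ true
  τ-∩ {A = A} {Y = Y} τA A∩Y≤A with τ-orients (≤-<-trans A∩Y≤A (τ-order A τA))
  ... | inj₁ τA∩Y  = τA∩Y
  ... | inj₂ τ∁A∩Y = contradiction (p∪∁[p∩q]∪p≡⊤ A Y) (noCover A (∁ (A ∩ Y)) A τA τ∁A∩Y τA)

  τ-∁-corner : τ (∁ A) ≡ true → order M (A ∩ C) ≤ order M A → order M (A ∩ ∁ C) ≤ order M A →
               τ (∁ (A ∩ C)) ≡ true ⊎ τ (∁ (A ∩ ∁ C)) ≡ true
  τ-∁-corner {A = A} {C = C} τ∁A A∩C≤A A∩∁C≤A
    with τ-orients (≤-<-trans A∩C≤A A<k) | τ-orients (≤-<-trans A∩∁C≤A A<k)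
    where
    A<k : order M A < k
    A<k = subst (_< k) (order-∁ M A) (τ-order (∁ A) τ∁A)
  ... | inj₂ τ∁A∩C | _           = inj₁ τ∁A∩C
  ... | inj₁ _     | inj₂ τ∁A∩∁C = inj₂ τ∁A∩∁C
  ... | inj₁ τA∩C  | inj₁ τA∩∁C  =
    contradiction (p∩q∪p∩∁q∪∁p≡⊤ A C) (noCover (A ∩ C) (A ∩ ∁ C) (∁ A) τA∩C τA∩∁C τ∁A)

module _ (M : Matroid n) where
  open Tangle

  distinguishes? : ∀ t t' → Decidable (λ A → Distinguishes M A t t')
  distinguishes? t t' A =
    (τ t A ≟ᵇ true ×-dec τ t' (∁ A) ≟ᵇ true) ⊎-dec (τ t (∁ A) ≟ᵇ true ×-dec τ t' A ≟ᵇ true)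

  efficientlyDistinguishes? : ∀ t t' → Decidable (λ A → EfficientlyDistinguishes M A t t')
  efficientlyDistinguishes? t t' A =
    distinguishes? t t' A ×-dec ∀-Subset? λ C → distinguishes? t t' C →-dec order M A ≤? order M C

  module _ (t t' : Tangle M) where

    Distinguishes-∁ : Distinguishes M A t t' → Distinguishes M (∁ A) t t'
    Distinguishes-∁ {A = A} (inj₁ (τA , τ'∁A)) =
      inj₂ (subst (λ Z → τ t Z ≡ true) (sym (∁-involutive A)) τA , τ'∁A)
    Distinguishes-∁ {A = A} (inj₂ (τ∁A , τ'A)) =
      inj₁ (τ∁A , subst (λ Z → τ t' Z ≡ true) (sym (∁-involutive A)) τ'A)

    EfficientlyDistinguishes-∁ : EfficientlyDistinguishes M A t t' →
                                 EfficientlyDistinguishes M (∁ A) t t'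
    EfficientlyDistinguishes-∁ {A = A} (dist , A-min) =
      Distinguishes-∁ dist , λ C distC → subst (_≤ order M C) (sym (order-∁ M A)) (A-min C distC)

    distinguishes⇒nonempty : Distinguishes M A t t' → Nonempty A
    distinguishes⇒nonempty {A = A} dist with nonempty? A
    ... | yes ne  = ne
    ... | no ¬ne with subst (λ Z → Distinguishes M Z t t') (Empty-unique ¬ne) dist
    ...   | inj₁ (_ , τ'∁∅) = contradiction (subst (λ Z → τ t' Z ≡ true) ∁∅≡⊤ τ'∁∅) (¬τ⊤ t')
    ...   | inj₂ (τ∁∅ , _)  = contradiction (subst (λ Z → τ t Z ≡ true) ∁∅≡⊤ τ∁∅) (¬τ⊤ t)

    Distinguishes-corner : Distinguishes M A t t' →
      order M (A ∩ C) ≤ order M A → order M (A ∩ ∁ C) ≤ order M A →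
      Distinguishes M (A ∩ C) t t' ⊎ Distinguishes M (A ∩ ∁ C) t t'
    Distinguishes-corner (inj₁ (τA , τ'∁A)) A∩C≤A A∩∁C≤A =
      Sum.map (λ τ'∁A∩C → inj₁ (τ-∩ t τA A∩C≤A , τ'∁A∩C))
              (λ τ'∁A∩∁C → inj₁ (τ-∩ t τA A∩∁C≤A , τ'∁A∩∁C))
              (τ-∁-corner t' τ'∁A A∩C≤A A∩∁C≤A)
    Distinguishes-corner (inj₂ (τ∁A , τ'A)) A∩C≤A A∩∁C≤A =
      Sum.map (λ τ∁A∩C → inj₂ (τ∁A∩C , τ-∩ t' τ'A A∩C≤A))
              (λ τ∁A∩∁C → inj₂ (τ∁A∩∁C , τ-∩ t' τ'A A∩∁C≤A))
              (τ-∁-corner t τ∁A A∩C≤A A∩∁C≤A)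

    EfficientlyDistinguishes-≤ : EfficientlyDistinguishes M A t t' → Distinguishes M X t t' →
      order M X ≤ order M A → order M X ≡ order M A × EfficientlyDistinguishes M X t t'
    EfficientlyDistinguishes-≤ (_ , A-min) distX X≤A =
      ≤-antisym X≤A (A-min _ distX) , distX , λ C distC → ≤-trans X≤A (A-min C distC)

    efficientDistinguishers : SepSet n
    efficientDistinguishers A = does (efficientlyDistinguishes? t t' A)

    efficient⇒∈ : EfficientlyDistinguishes M A t t' → Mem efficientDistinguishers A
    efficient⇒∈ {A = A} eff = inj₁ (dec-true (efficientlyDistinguishes? t t' A) eff)

    ∈⇒efficient : Mem efficientDistinguishers A → EfficientlyDistinguishes M A t t'
    ∈⇒efficient {A = A} (inj₁ A∈)  = does⇒witness (efficientlyDistinguishes? t t' A) A∈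
    ∈⇒efficient {A = A} (inj₂ ∁A∈) =
      subst (λ Z → EfficientlyDistinguishes M Z t t') (∁-involutive A)
      (EfficientlyDistinguishes-∁ (does⇒witness (efficientlyDistinguishes? t t' (∁ A)) ∁A∈))

    efficientDistinguishers-entanglement : Distinguishable M t t' →
                                           IsEntanglement M efficientDistinguishers
    efficientDistinguishers-entanglement (_ , dist) = record
      { nonempty =
          let A , distA , A-min = minimiser ∈-allSubsets (distinguishes? t t') (order M) dist
          in A , efficient⇒∈ (distA , A-min)
      ; closure  = λ A C A∈ _ A∩C≤A A∩∁C≤A →
          let effA = ∈⇒efficient A∈
              corner-efficient = λ {X} (distX : Distinguishes M X t t') X≤A →
                map₂ efficient⇒∈ (EfficientlyDistinguishes-≤ effA distX X≤A)
          in Sum.map (λ distX → corner-efficient distX A∩C≤A)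
                     (λ distX → corner-efficient distX A∩∁C≤A)
                     (Distinguishes-corner (proj₁ effA) A∩C≤A A∩∁C≤A) }

    friendly-efficient-distinguisher : Distinguishable M t t' →
                                       ∃ λ S → Friendly M S × EfficientlyDistinguishes M S t t'
    friendly-efficient-distinguisher distinguishable =
      least-is-friendly (minimiser ∈-allSubsets (mem? efficientDistinguishers) (crossingNumber M)
                                   (proj₂ (IsEntanglement.nonempty entanglement)))
      where
      entanglement : IsEntanglement M efficientDistinguishers
      entanglement = efficientDistinguishers-entanglement distinguishable
      least-is-friendly : (∃ λ S → Mem efficientDistinguishers S × ∀ T → Mem efficientDistinguishers T →
                                   crossingNumber M S ≤ crossingNumber M T) →
                          ∃ λ S → Friendly M S × EfficientlyDistinguishes M S t t'
      least-is-friendly (S , S∈E , S-least) =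
        S , (efficientDistinguishers , entanglement , S∈E ,
             λ T T∈E T<S → <⇒≱ (CrossesFewer⇒< M T<S) (S-least T T∈E)) ,
        ∈⇒efficient S∈E

-- Laminar families and trees

EdgeSep-unique : ∀ (T : TreeDecomposition n) {i A B} →
                 TreeDecomposition.EdgeSep T i A → TreeDecomposition.EdgeSep T i B → A ≡ B
EdgeSep-unique T sepA sepB =
  ⊆-antisym (λ {x} x∈A → proj₂ (sepB x) (proj₁ (sepA x) x∈A))
            (λ {x} x∈B → proj₂ (sepA x) (proj₁ (sepB x) x∈B))

-- Vertex suc i carries S i and vertex zero is the root; the parent of S i is
-- the smallest member strictly containing it, and an element of the ground
-- set sits at the smallest member containing it.
module LaminarTree {m : ℕ} (S : Fin m → Subset n)
  (S-nonempty : ∀ i → Nonempty (S i))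
  (S-laminar : ∀ i j → S i ⊆ S j ⊎ S j ⊆ S i ⊎ S i ⊆ ∁ (S j))
  (S-ordered : ∀ i j → toℕ i < toℕ j → ¬ S i ⊆ S j) where

  common-element⇒⊆ : ∀ {x j k} → x ∈ S j → x ∈ S k → ∣ S j ∣ ≤ ∣ S k ∣ → S j ⊆ S k
  common-element⇒⊆ {j = j} {k} x∈Sj x∈Sk ∣Sj∣≤∣Sk∣ with S-laminar j k
  ... | inj₁ Sj⊆Sk         = Sj⊆Sk
  ... | inj₂ (inj₁ Sk⊆Sj)  = q⊆p⇒∣p∣≤∣q∣⇒p⊆q Sk⊆Sj ∣Sj∣≤∣Sk∣
  ... | inj₂ (inj₂ Sj⊆∁Sk) = contradiction x∈Sk (x∈∁p⇒x∉p (Sj⊆∁Sk x∈Sj))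

  _⊏_ : Fin m → Fin m → Set
  i ⊏ k = S i ⊆ S k × ¬ S k ⊆ S i

  _⊏?_ : ∀ i k → Dec (i ⊏ k)
  i ⊏? k = S i ⊆? S k ×-dec ¬? (S k ⊆? S i)

  ⊏⇒> : ∀ {i k} → i ⊏ k → toℕ k < toℕ i
  ⊏⇒> {i} {k} (Si⊆Sk , Sk⊈Si) with <-cmp (toℕ i) (toℕ k)
  ... | tri< i<k _ _ = ⊥-elim (S-ordered i k i<k Si⊆Sk)
  ... | tri≈ _ i≡k _ = ⊥-elim (Sk⊈Si (subst (λ j → S j ⊆ S i) (toℕ-injective i≡k) ⊆-refl))
  ... | tri> _ _ k<i = k<i

  Least : (Fin m → Set) → Set
  Least P = (∃ λ k → P k × ∀ k' → P k' → ∣ S k ∣ ≤ ∣ S k' ∣) ⊎ (∀ k → ¬ P k)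

  least : ∀ {P} → Decidable P → Least P
  least P? with any? P?
  ... | yes (k , Pk) = inj₁ (minimiser ∈-allFin P? (∣_∣ ∘ S) Pk)
  ... | no ∄P        = inj₂ λ k Pk → ∄P (k , Pk)

  vertex : ∀ {P} → Least P → Fin (suc m)
  vertex (inj₁ (k , _)) = suc k
  vertex (inj₂ _)       = zero

  above : ∀ i → Least (i ⊏_)
  above i = least (i ⊏?_)

  placement : ∀ x → Least (λ k → x ∈ S k)
  placement x = least (λ k → x ∈? S k)

  parent : Fin m → Fin (suc m)
  parent i = vertex (above i)

  parent-< : ∀ i → toℕ (parent i) ≤ toℕ i
  parent-< i with above i
  ... | inj₁ (_ , i⊏k , _) = ⊏⇒> i⊏k
  ... | inj₂ _             = z≤n

  tree : TreeDecomposition n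
  tree = record { m = m ; parent = parent ; parent-< = parent-< ; φ = vertex ∘ placement }

  open TreeDecomposition tree using (Below; here; step; EdgeSep)

  Below⇒⊆ : ∀ {i k} → Below (suc i) (suc k) → S k ⊆ S i
  Below-vertex⇒⊆ : ∀ {i} k (l : Least (k ⊏_)) → Below (suc i) (vertex l) → S k ⊆ S i
  Below⇒⊆ here       = ⊆-refl
  Below⇒⊆ (step k b) = Below-vertex⇒⊆ k (above k) b
  Below-vertex⇒⊆ k (inj₁ (_ , k⊏k' , _)) b = ⊆-trans (proj₁ k⊏k') (Below⇒⊆ b)
  Below-vertex⇒⊆ k (inj₂ _) ()

  ⊆⇒Below : ∀ {i} k → Acc _<_ (toℕ k) → S k ⊆ S i → Below (suc i) (suc k)
  Below-vertex : ∀ {i} k → Acc _<_ (toℕ k) → k ⊏ i → (l : Least (k ⊏_)) → Below (suc i) (vertex l)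
  ⊆⇒Below {i} k rec Sk⊆Si with k ≟ᶠ i
  ... | yes refl = here
  ... | no k≢i   = step k (Below-vertex k rec (Sk⊆Si , Si⊈Sk) (above k))
    where
    Si⊈Sk : ¬ S i ⊆ S k
    Si⊈Sk Si⊆Sk with <-cmp (toℕ k) (toℕ i)
    ... | tri< k<i _ _ = S-ordered k i k<i Sk⊆Si
    ... | tri≈ _ k≡i _ = k≢i (toℕ-injective k≡i)
    ... | tri> _ _ i<k = S-ordered i k i<k Si⊆Sk
  Below-vertex k _ k⊏i (inj₂ nothing-above) = ⊥-elim (nothing-above _ k⊏i)
  Below-vertex {i} k (acc rec) k⊏i (inj₁ (k' , k⊏k' , k'-least)) =
    ⊆⇒Below k' (rec (⊏⇒> k⊏k'))
      (common-element⇒⊆ (proj₁ k⊏k' x∈Sk) (proj₁ k⊏i x∈Sk) (k'-least i k⊏i))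
    where
    x∈Sk : proj₁ (S-nonempty k) ∈ S k
    x∈Sk = proj₂ (S-nonempty k)

  edgeSep : ∀ i → EdgeSep i (S i)
  edgeSep i x = ∈⇒Below (placement x) , Below⇒∈ (placement x)
    where
    ∈⇒Below : (l : Least (λ k → x ∈ S k)) → x ∈ S i → Below (suc i) (vertex l)
    ∈⇒Below (inj₁ (k , x∈Sk , k-least)) x∈Si =
      ⊆⇒Below k (<-wellFounded (toℕ k)) (common-element⇒⊆ x∈Sk x∈Si (k-least i x∈Si))
    ∈⇒Below (inj₂ nowhere) x∈Si = ⊥-elim (nowhere i x∈Si)
    Below⇒∈ : (l : Least (λ k → x ∈ S k)) → Below (suc i) (vertex l) → x ∈ S i
    Below⇒∈ (inj₁ (k , x∈Sk , _)) b = Below⇒⊆ b x∈Sk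
    Below⇒∈ (inj₂ _) ()

-- A friendly separation is represented by its side avoiding the element zero.
module FriendlyTree (M : Matroid (suc n)) where

  Representative : Subset (suc n) → Set
  Representative X = Friendly M X × zero ∉ X × Nonempty X

  representative? : Decidable Representative
  representative? X = friendly? M X ×-dec ¬? (zero ∈? X) ×-dec nonempty? X

  -- Abstract, so that the type checker never unfolds the decision procedure
  -- for friendliness.
  abstract
    representatives : List (Subset (suc n))
    representatives = filter representative? (allSubsets (suc n))

    representatives-sound : X ∈ₗ representatives → Representative X
    representatives-sound = proj₂ ∘ ∈-filter⁻ representative? {xs = allSubsets (suc n)}

    representatives-complete : Representative X → X ∈ₗ representatives
    representatives-complete {X = X} = ∈-filter⁺ representative? (∈-allSubsets X)

    representatives-⊈ : AllPairs (λ X Y → ¬ X ⊆ Y) representatives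
    representatives-⊈ = AllPairs.filter⁺ representative? (allSubsets-⊈ (suc n))

  S : Fin (length representatives) → Subset (suc n)
  S = List.lookup representatives

  S-representative : ∀ i → Representative (S i)
  S-representative i = representatives-sound (∈-lookup i)

  representative-index : Representative X → ∃ λ i → S i ≡ X
  representative-index {X = X} X-rep = Any.index X∈ , sym (lookup-index X∈)
    where
    X∈ : X ∈ₗ representatives
    X∈ = representatives-complete X-rep

  S-laminar : ∀ i j → S i ⊆ S j ⊎ S j ⊆ S i ⊎ S i ⊆ ∁ (S j)
  S-laminar i j with S-representative i | S-representative j
  ... | Si! , 0∉Si , _ | Sj! , 0∉Sj , _ with Nested⇒Nested⊆ (friendly-nested M _ _ Si! Sj!)
  ... | inj₁ Si⊆Sj                 = inj₁ Si⊆Sj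
  ... | inj₂ (inj₁ Si⊆∁Sj)         = inj₂ (inj₂ Si⊆∁Sj)
  ... | inj₂ (inj₂ (inj₁ ∁Si⊆Sj))  = ⊥-elim (0∉Sj (∁Si⊆Sj (x∉p⇒x∈∁p 0∉Si)))
  ... | inj₂ (inj₂ (inj₂ ∁Si⊆∁Sj)) = inj₂ (inj₁ (∁p⊆∁q⇒p⊇q ∁Si⊆∁Sj))

  open LaminarTree S (proj₂ ∘ proj₂ ∘ S-representative) S-laminar
    (AllPairs-lookup representatives-⊈)
    public using (tree; edgeSep)

  edge-friendly : ∀ i A → TreeDecomposition.EdgeSep tree i A → Friendly M A
  edge-friendly i A sepA =
    subst (Friendly M) (EdgeSep-unique tree (edgeSep i) sepA) (proj₁ (S-representative i))

  representative-side : ∀ t t' → (∃ λ X → Friendly M X × EfficientlyDistinguishes M X t t') →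
                        ∃ λ X → Representative X × EfficientlyDistinguishes M X t t'
  representative-side t t' (X , X! , effX) with zero ∈? X
  ... | no 0∉X  = X , (X! , 0∉X , distinguishes⇒nonempty M t t' (proj₁ effX)) , effX
  ... | yes 0∈X =
    ∁ X , (Friendly-∁ M X! , x∈p⇒x∉∁p 0∈X , distinguishes⇒nonempty M t t' (proj₁ eff∁X)) , eff∁X
    where
    eff∁X : EfficientlyDistinguishes M (∁ X) t t'
    eff∁X = EfficientlyDistinguishes-∁ M t t' effX

  on-edge : ∀ t t' → (∃ λ X → Representative X × EfficientlyDistinguishes M X t t') →
            TDEfficientlyDistinguishes M tree t t'
  on-edge t t' (X , X-rep , effX) with representative-index X-rep
  ... | i , refl = i , S i , edgeSep i , effX

  tree-efficient : ∀ t t' → Distinguishable M t t' → TDEfficientlyDistinguishes M tree t t'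
  tree-efficient t t' =
    on-edge t t' ∘ representative-side t t' ∘ friendly-efficient-distinguisher M t t'

∄Nonempty-Subset-zero : {X : Subset 0} → ¬ Nonempty X
∄Nonempty-Subset-zero (() , _)

theorem5p4 : {n : ℕ} (M : Matroid n) →
    (∀ (A C : Subset n) → Friendly M A → Friendly M C → Nested A C)
    × Σ (TreeDecomposition n) (λ T →
        (∀ i A → TreeDecomposition.EdgeSep T i A → Friendly M A)
        × (∀ (t t' : Tangle M) → Distinguishable M t t' →
             TDEfficientlyDistinguishes M T t t'))
theorem5p4 {zero} M =
  friendly-nested M ,
  record { m = 0 ; parent = λ () ; parent-< = λ () ; φ = λ () } ,
  (λ ()) ,
  λ t t' (_ , dist) → ⊥-elim (∄Nonempty-Subset-zero (distinguishes⇒nonempty M t t' dist))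
theorem5p4 {suc n} M = friendly-nested M , tree , edge-friendly , tree-efficient
  where open FriendlyTree M
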